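{- Let $\Phi$ be one of the following three classes of modal formulas: the very simple Sahlqvist implications, the Sahlqvist implications, or the atomic inductive implications. Then every $\phi\in\Phi$ is semantically equivalent (i.e.\ true at exactly the same states of every Kripke model) to a finite conjunction of definite implications belonging to $\Phi$.
   Context: The basic modal language over a set $\mathsf{Prop}$ of propositional variables is given by $\varphi::= p \mid \bot \mid \neg\varphi \mid \varphi\vee\varphi \mid \Diamond\varphi$, with $\Box\varphi:=\neg\Diamond\neg\varphi$ and $\top,\wedge,\rightarrow$ defined as usual. An occurrence of a variable is positive (negative) if it is in the scope of an even (odd) number of negations (counting those introduced by $\rightarrow$). A formula is positive (negative) if all occurrences of variables in it are positive (negative). A very simple Sahlqvist antecedent is a formula built from $\top$, $\bot$, negative formulas and propositional variables using $\vee,\wedge,\Diamond$. A boxed atom is a formula $\Box^n p$ with $n\in\mathbb{N}$, $p\in\mathsf{Prop}$. A Sahlqvist antecedent is built from $\top$, $\bot$, negative formulas and boxed atoms using $\vee,\wedge,\Diamond$. An atomic box-formula of $p$ is a formula of the form $\Box(p_0\rightarrow\Box(p_1\rightarrow\cdots\Box(p_n\rightarrow\Box^k p)\cdots))$ ($n\ge 0$ steps, possibly none, $k\in\mathbb{N}$, the $p_i$ not necessarily distinct); the displayed final occurrence of $p$ is its head, all other variable occurrences are inessential. The dependency digraph of a set of atomic box-formulas has as vertices their heads, with an edge $p_i\to p_j$ iff $p_i$ occurs inessentially in a box-formula of the set with head $p_j$; the dependency digraph of a formula is that of the set of atomic box-formulas occurring as its subformulas. An atomic regular antecedent is built from $\top$,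 $\bot$, negative formulas and atomic box-formulas using $\vee,\wedge,\Diamond$; an atomic inductive antecedent is an atomic regular antecedent whose dependency digraph is acyclic. A very simple Sahlqvist (resp.\ Sahlqvist, atomic inductive) implication is an implication $\phi\rightarrow\psi$ with $\psi$ positive and $\phi$ a very simple Sahlqvist (resp.\ Sahlqvist, atomic inductive) antecedent. The corresponding definite antecedents are those built in the same way but using only $\wedge$ and $\Diamond$ (so $\vee$ may occur only inside negative formulas); a definite implication of the class is one whose antecedent is a definite antecedent of that class. -}

module Defs where

open import Data.Nat using (ℕ; zero; suc)
open import Data.List using (List; []; _∷_)
open import Data.List.Membership.Propositional using (_∈_)
open import Data.Product using (Σ; _×_; _,_)
open import Data.Empty using (⊥)
open import Relation.Nullary using (¬_)
open import Relation.Binary.PropositionalEquality using (_≡_)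
open import Relation.Binary.Construct.Closure.Transitive using (TransClosure)
open import Function.Bundles using (_⇔_)

data Fm (Prop : Set) : Set where
  var  : Prop → Fm Prop
  ⊥'   : Fm Prop
  ¬'_  : Fm Prop → Fm Prop
  _∨'_ : Fm Prop → Fm Prop → Fm Prop
  ◇_   : Fm Prop → Fm Prop

infixr 6 _∨'_
infix 7 ¬'_ ◇_

module _ {Prop : Set} where

  infixr 6 _∧'_
  infixr 5 _⇒_
  infix 7 □_

  ⊤' : Fm Prop
  ⊤' = ¬' ⊥'

  _∧'_ : Fm Prop → Fm Prop → Fm Prop
  φ ∧' ψ = ¬' ((¬' φ) ∨' (¬' ψ))

  _⇒_ : Fm Prop → Fm Prop → Fm Prop
  φ ⇒ ψ = (¬' φ) ∨' ψ

  □_ : Fm Prop → Fm Prop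
  □ φ = ¬' (◇ (¬' φ))

  □^ : ℕ → Fm Prop → Fm Prop
  □^ zero    φ = φ
  □^ (suc n) φ = □ (□^ n φ)

  ⋀ : List (Fm Prop) → Fm Prop
  ⋀ []       = ⊤'
  ⋀ (φ ∷ φs) = φ ∧' ⋀ φs

  -- Polarity: all variable occurrences positive / negative
  -- (negations introduced by the abbreviations are counted, since
  --  they are literally ¬' in the syntax)

  data Positive : Fm Prop → Set
  data Negative : Fm Prop → Set

  data Positive where
    var : ∀ p → Positive (var p)
    bot : Positive ⊥'
    neg : ∀ {φ} → Negative φ → Positive (¬' φ)
    or  : ∀ {φ ψ} → Positive φ → Positive ψ → Positive (φ ∨' ψ)
    dia : ∀ {φ} → Positive φ → Positive (◇ φ)

  data Negative where
    bot : Negative ⊥'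
    neg : ∀ {φ} → Positive φ → Negative (¬' φ)
    or  : ∀ {φ ψ} → Negative φ → Negative ψ → Negative (φ ∨' ψ)
    dia : ∀ {φ} → Negative φ → Negative (◇ φ)

  data IsVar : Fm Prop → Set where
    isVar : ∀ p → IsVar (var p)

  data BoxedAtom : Fm Prop → Set where
    boxedAtom : ∀ n p → BoxedAtom (□^ n (var p))

  -- atomic box-formula □(p₀ → □(p₁ → ⋯ □(pₙ → □^k p)⋯)) with list
  -- [p₀,…,pₙ] of inessential variables (possibly empty), k, and head p
  abf : List Prop → ℕ → Prop → Fm Prop
  abf []       k p = □^ k (var p)
  abf (q ∷ qs) k p = □ (var q ⇒ abf qs k p)

  data AtomicBox : Fm Prop → Set where
    atomicBox : ∀ qs k p → AtomicBox (abf qs k p)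

  data Sub : Fm Prop → Fm Prop → Set where
    here : ∀ {φ} → Sub φ φ
    neg  : ∀ {χ φ} → Sub χ φ → Sub χ (¬' φ)
    orl  : ∀ {χ φ ψ} → Sub χ φ → Sub χ (φ ∨' ψ)
    orr  : ∀ {χ φ ψ} → Sub χ ψ → Sub χ (φ ∨' ψ)
    dia  : ∀ {χ φ} → Sub χ φ → Sub χ (◇ φ)

  Edge : Fm Prop → Prop → Prop → Set
  Edge φ a b = Σ (List Prop) λ qs → Σ ℕ λ k → Sub (abf qs k b) φ × a ∈ qs

  Acyclic : Fm Prop → Set
  Acyclic φ = ∀ a → ¬ TransClosure (Edge φ) a a

  data Shape : Set where
    general definite : Shape

  data Ante (At : Fm Prop → Set) : Shape → Fm Prop → Set where
    top  : ∀ {s} → Ante At s ⊤'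
    bot  : ∀ {s} → Ante At s ⊥'
    neg  : ∀ {s φ} → Negative φ → Ante At s φ
    atom : ∀ {s φ} → At φ → Ante At s φ
    and  : ∀ {s φ ψ} → Ante At s φ → Ante At s ψ → Ante At s (φ ∧' ψ)
    dia  : ∀ {s φ} → Ante At s φ → Ante At s (◇ φ)
    or   : ∀ {φ ψ} → Ante At general φ → Ante At general ψ → Ante At general (φ ∨' ψ)

data Class : Set where
  verySimpleSahlqvist sahlqvist atomicInductive : Class

module _ {Prop : Set} where

  AnteOf : Class → Shape → Fm Prop → Set
  AnteOf verySimpleSahlqvist s φ = Ante IsVar s φ
  AnteOf sahlqvist           s φ = Ante BoxedAtom s φ
  AnteOf atomicInductive     s φ = Ante AtomicBox s φ × Acyclic φ

  InClass : Class → Shape → Fm Prop → Set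
  InClass c s χ = Σ (Fm Prop) λ φ → Σ (Fm Prop) λ ψ →
                  (χ ≡ (φ ⇒ ψ)) × AnteOf c s φ × Positive ψ

-- Kripke semantics (classical, via the Gödel–Gentzen negative
-- translation so that it is the standard two-valued semantics)

record Model (Prop : Set) : Set₁ where
  field
    W : Set
    R : W → W → Set
    V : Prop → W → Set

module _ {Prop : Set} (M : Model Prop) where
  open Model M

  _⊨_ : W → Fm Prop → Set
  w ⊨ var p    = ¬ ¬ V p w
  w ⊨ ⊥'       = ⊥
  w ⊨ (¬' φ)   = ¬ (w ⊨ φ)
  w ⊨ (φ ∨' ψ) = ¬ (¬ (w ⊨ φ) × ¬ (w ⊨ ψ))
  w ⊨ (◇ φ)    = ¬ (∀ v → R w v → ¬ (v ⊨ φ))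

SemEquiv : {Prop : Set} → Fm Prop → Fm Prop → Set₁
SemEquiv {Prop} φ ψ = (M : Model Prop) (w : Model.W M) → (_⊨_ M w φ ⇔ _⊨_ M w ψ)

module Submission where

-- Distributing ∧ and ◇ over ∨ turns an antecedent φ into a semantically
-- equivalent disjunction π₁ ∨ ⋯ ∨ πₙ of definite antecedents built from the
-- same atoms, and (π₁ ∨ ⋯ ∨ πₙ) → ψ is equivalent to ⋀ᵢ (πᵢ → ψ).  For atomic
-- inductive antecedents the πᵢ stay acyclic: every atomic box-formula with an
-- inessential variable that occurs in πᵢ already occurs in φ, so the dependency
-- digraph of πᵢ is a subgraph of that of φ.

open import Defs
open import Data.List using (List; []; _∷_; _++_; map; cartesianProductWith)
open import Data.List.Relation.Unary.All as All using (All; []; _∷_)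
open import Data.List.Relation.Unary.All.Properties using (++⁺; map⁺; map⁻; cartesianProductWith⁺)
open import Data.List.Relation.Unary.Any as Any using (Any; here)
import Data.List.Relation.Unary.Any.Properties as Anyₚ
open import Data.Nat using (zero; suc)
open import Data.Product using (Σ; _×_; _,_; proj₁; proj₂)
open import Data.Empty using (⊥-elim)
open import Function using (_∘_)
open import Function.Bundles using (_⇔_; mk⇔; Equivalence)
import Function.Related.Propositional as Related
open import Function.Properties.Equivalence using () renaming (sym to ⇔-sym)
open Equivalence using (to; from)
open import Relation.Nullary using (¬_)
open import Relation.Binary.PropositionalEquality using (_≢_; refl; setoid)
open import Relation.Binary.Construct.Closure.Transitive using (TransClosure; [_]; _∷_)

All-cartesianProductWith⁺ : ∀ {A B C : Set} {P : A → Set} {Q : B → Set} {R : C → Set}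
  (f : A → B → C) {xs ys} → All P xs → All Q ys →
  (∀ {x y} → P x → Q y → R (f x y)) → All R (cartesianProductWith f xs ys)
All-cartesianProductWith⁺ f {xs} {ys} pxs qys pres =
  cartesianProductWith⁺ (setoid _) (setoid _) f xs ys
    (λ x∈xs y∈ys → pres (All.lookup pxs x∈xs) (All.lookup qys y∈ys))

module _ {Prop : Set} where

  infixr 6 _⊓_

  -- The padding matters: ¬' ◇ (var q ∧' b) is the atomic box-formula
  -- □ (q → ¬' b) whenever ¬' b is one, which would add the edge q → head;
  -- ¬' (b ∧' ⊤') is never an atomic box-formula.

  _⊓_ : Fm Prop → Fm Prop → Fm Prop
  φ ⊓ ψ = φ ∧' (ψ ∧' ⊤')

  disjuncts : ∀ {At : Fm Prop → Set} {φ} → Ante At general φ → List (Fm Prop)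
  disjuncts {φ = φ} top      = φ ∷ []
  disjuncts {φ = φ} bot      = φ ∷ []
  disjuncts {φ = φ} (neg _)  = φ ∷ []
  disjuncts {φ = φ} (atom _) = φ ∷ []
  disjuncts (and d e)        = cartesianProductWith _⊓_ (disjuncts d) (disjuncts e)
  disjuncts (dia d)          = map ◇_ (disjuncts d)
  disjuncts (or d e)         = disjuncts d ++ disjuncts e

  disjuncts-definite : ∀ {At : Fm Prop → Set} {φ} (d : Ante At general φ) →
                       All (Ante At definite) (disjuncts d)
  disjuncts-definite top      = top ∷ []
  disjuncts-definite bot      = bot ∷ []
  disjuncts-definite (neg n)  = neg n ∷ []
  disjuncts-definite (atom a) = atom a ∷ []
  disjuncts-definite (and d e) =
    All-cartesianProductWith⁺ _⊓_ (disjuncts-definite d) (disjuncts-definite e)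
      (λ a b → and a (and b top))
  disjuncts-definite (dia d)  = map⁺ (All.map dia (disjuncts-definite d))
  disjuncts-definite (or d e) = ++⁺ (disjuncts-definite d) (disjuncts-definite e)

  -- The atomic box-formulas with at least one step, the only ones carrying edges.
  data ProperBox : Fm Prop → Set where
    properBox : ∀ q {χ} → AtomicBox χ → ProperBox (□ (var q ⇒ χ))

  -- ¬' π and ¬' ◇ π are the only atomic box-formulas that ⊓ and ◇ can create
  -- around a disjunct π.
  BoxInert : Fm Prop → Set
  BoxInert π = ¬ ProperBox (¬' π) × ¬ ProperBox (¬' ◇ π)

  BoxesIn : Fm Prop → Fm Prop → Set
  BoxesIn φ π = ∀ {χ : Fm Prop} → ProperBox χ → Sub χ π → Sub χ φ

  atomicBox≢¬¬ : ∀ {χ X : Fm Prop} → AtomicBox χ → χ ≢ ¬' ¬' X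
  atomicBox≢¬¬ (atomicBox []      zero    _) ()
  atomicBox≢¬¬ (atomicBox []      (suc _) _) ()
  atomicBox≢¬¬ (atomicBox (_ ∷ _) _       _) ()

  atomicBox-inert : ∀ {χ : Fm Prop} → AtomicBox χ → BoxInert χ
  atomicBox-inert (atomicBox []      zero    _) = (λ ()) , (λ ())
  atomicBox-inert (atomicBox []      (suc _) _) = (λ ()) , (λ ())
  atomicBox-inert (atomicBox (_ ∷ _) _       _) = (λ ()) , (λ ())

  negative-inert : ∀ {φ : Fm Prop} → Negative φ → BoxInert φ
  negative-inert n = ¬dual n , ¬dual◇ n
    where
    ¬dual : ∀ {φ : Fm Prop} → Negative φ → ¬ ProperBox (¬' φ)
    ¬dual (dia (neg (or (neg ()) _))) (properBox _ _)
    ¬dual◇ : ∀ {φ : Fm Prop} → Negative φ → ¬ ProperBox (¬' ◇ φ)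
    ¬dual◇ (neg (or (neg ()) _)) (properBox _ _)

  ⊓-inert : ∀ {a b : Fm Prop} → BoxInert (a ⊓ b)
  ⊓-inert = (λ ()) , λ { (properBox _ box) → atomicBox≢¬¬ box refl }

  ⊓-boxes : ∀ {φ ψ a b : Fm Prop} → BoxInert a → BoxInert b →
            BoxesIn φ a → BoxesIn ψ b → BoxesIn (φ ∧' ψ) (a ⊓ b)
  ⊓-boxes ia ib sa sb box (neg (orl here))                         = ⊥-elim (proj₁ ia box)
  ⊓-boxes ia ib sa sb box (neg (orl (neg s)))                      = neg (orl (neg (sa box s)))
  ⊓-boxes ia ib sa sb box (neg (orr (neg (neg (orl here)))))       = ⊥-elim (proj₁ ib box)
  ⊓-boxes ia ib sa sb box (neg (orr (neg (neg (orl (neg s))))))    = neg (orr (neg (sb box s)))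
  ⊓-boxes ia ib sa sb () (neg (orr (neg (neg (orr (neg (neg here)))))))

  NoNewBoxes : Fm Prop → Fm Prop → Set
  NoNewBoxes φ π = BoxInert π × BoxesIn φ π

  ⊓-noNewBoxes : ∀ {φ ψ a b : Fm Prop} →
                 NoNewBoxes φ a → NoNewBoxes ψ b → NoNewBoxes (φ ∧' ψ) (a ⊓ b)
  ⊓-noNewBoxes (ia , sa) (ib , sb) = ⊓-inert , ⊓-boxes ia ib sa sb

  ◇-noNewBoxes : ∀ {φ a : Fm Prop} → NoNewBoxes φ a → NoNewBoxes (◇ φ) (◇ a)
  ◇-noNewBoxes (ia , sa) = (proj₂ ia , λ ()) , λ { box (dia s) → dia (sa box s) }

  ∨-noNewBoxesˡ : ∀ {φ ψ a : Fm Prop} → NoNewBoxes φ a → NoNewBoxes (φ ∨' ψ) a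
  ∨-noNewBoxesˡ (ia , sa) = ia , λ box s → orl (sa box s)

  ∨-noNewBoxesʳ : ∀ {φ ψ b : Fm Prop} → NoNewBoxes ψ b → NoNewBoxes (φ ∨' ψ) b
  ∨-noNewBoxesʳ (ib , sb) = ib , λ box s → orr (sb box s)

  disjuncts-noNewBoxes : ∀ {φ : Fm Prop} (d : Ante AtomicBox general φ) →
                         All (NoNewBoxes φ) (disjuncts d)
  disjuncts-noNewBoxes top       = (((λ ()) , (λ ())) , (λ _ s → s)) ∷ []
  disjuncts-noNewBoxes bot       = (((λ ()) , (λ ())) , (λ _ s → s)) ∷ []
  disjuncts-noNewBoxes (neg n)   = (negative-inert n , (λ _ s → s)) ∷ []
  disjuncts-noNewBoxes (atom a)  = (atomicBox-inert a , (λ _ s → s)) ∷ []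
  disjuncts-noNewBoxes (and d e) =
    All-cartesianProductWith⁺ _⊓_ (disjuncts-noNewBoxes d) (disjuncts-noNewBoxes e)
      ⊓-noNewBoxes
  disjuncts-noNewBoxes (dia d)   = map⁺ (All.map ◇-noNewBoxes (disjuncts-noNewBoxes d))
  disjuncts-noNewBoxes (or d e)  =
    ++⁺ (All.map ∨-noNewBoxesˡ (disjuncts-noNewBoxes d))
        (All.map ∨-noNewBoxesʳ (disjuncts-noNewBoxes e))

  edge-noNewBoxes : ∀ {φ π : Fm Prop} → NoNewBoxes φ π → ∀ {a b} → Edge π a b → Edge φ a b
  edge-noNewBoxes (_ , sub) (q ∷ qs , k , s , a∈qs) =
    q ∷ qs , k , sub (properBox q (atomicBox qs k _)) s , a∈qs

  acyclic-mono : ∀ {φ π : Fm Prop} →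
                 (∀ {a b} → Edge π a b → Edge φ a b) → Acyclic φ → Acyclic π
  acyclic-mono {φ} {π} edge⊆ acyclic a = acyclic a ∘ closure⊆
    where
    closure⊆ : ∀ {x y} → TransClosure (Edge π) x y → TransClosure (Edge φ) x y
    closure⊆ [ e ]    = [ edge⊆ e ]
    closure⊆ (e ∷ es) = edge⊆ e ∷ closure⊆ es

  disjuncts-acyclic : ∀ {φ : Fm Prop} (d : Ante AtomicBox general φ) →
                      Acyclic φ → All Acyclic (disjuncts d)
  disjuncts-acyclic d acyclic =
    All.map (λ noNew → acyclic-mono (edge-noNewBoxes noNew) acyclic) (disjuncts-noNewBoxes d)

  module Semantics (M : Model Prop) where
    open Model M

    infix 4 _⊩_

    _⊩_ : W → Fm Prop → Set
    _⊩_ = _⊨_ M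

    ⊩-stable : ∀ {w} φ → ¬ ¬ w ⊩ φ → w ⊩ φ
    ⊩-stable (var _)  h = λ ¬v → h (λ v → v ¬v)
    ⊩-stable ⊥'       h = h (λ ())
    ⊩-stable (¬' _)   h = λ ⊩φ → h (λ ¬φ → ¬φ ⊩φ)
    ⊩-stable (_ ∨' _) h = λ ⊩φ → h (λ ¬φ → ¬φ ⊩φ)
    ⊩-stable (◇ _)    h = λ ⊩φ → h (λ ¬φ → ¬φ ⊩φ)

    ⊩∧ : ∀ {w} φ ψ → w ⊩ φ ∧' ψ ⇔ (w ⊩ φ × w ⊩ ψ)
    ⊩∧ φ ψ = mk⇔ (λ h → ⊩-stable φ (λ ¬φ → h (λ (¬¬φ , _) → ¬¬φ ¬φ)) ,
                        ⊩-stable ψ (λ ¬ψ → h (λ (_ , ¬¬ψ) → ¬¬ψ ¬ψ)))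
                 (λ (⊩φ , ⊩ψ) k → k ((λ ¬φ → ¬φ ⊩φ) , (λ ¬ψ → ¬ψ ⊩ψ)))

    ⊩⊓ : ∀ {w} φ ψ → w ⊩ φ ⊓ ψ ⇔ (w ⊩ φ × w ⊩ ψ)
    ⊩⊓ φ ψ = mk⇔ (λ h → let (⊩φ , ⊩ψ∧⊤) = to (⊩∧ φ (ψ ∧' ⊤')) h
                         in ⊩φ , proj₁ (to (⊩∧ ψ ⊤') ⊩ψ∧⊤))
                 (λ (⊩φ , ⊩ψ) → from (⊩∧ φ (ψ ∧' ⊤')) (⊩φ , from (⊩∧ ψ ⊤') (⊩ψ , λ ())))

    ⊩⋀ : ∀ {w} φs → w ⊩ ⋀ φs ⇔ All (w ⊩_) φs
    ⊩⋀ []       = mk⇔ (λ _ → []) (λ _ ())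
    ⊩⋀ (φ ∷ φs) = mk⇔ (λ h → let (⊩φ , ⊩φs) = to (⊩∧ φ _) h in ⊩φ ∷ to (⊩⋀ φs) ⊩φs)
                      (λ { (⊩φ ∷ ⊩φs) → from (⊩∧ φ _) (⊩φ , from (⊩⋀ φs) ⊩φs) })

    ⊩⇒ : ∀ {w} φ ψ → w ⊩ φ ⇒ ψ ⇔ (w ⊩ φ → w ⊩ ψ)
    ⊩⇒ φ ψ = mk⇔ (λ h ⊩φ → ⊩-stable ψ (λ ¬ψ → h ((λ ¬φ → ¬φ ⊩φ) , ¬ψ)))
                 (λ f (¬¬φ , ¬ψ) → ¬¬φ (λ ⊩φ → ¬ψ (f ⊩φ)))

    disjuncts-entail : ∀ {At : Fm Prop → Set} {φ} (d : Ante At general φ) →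
                       All (λ π → ∀ w → w ⊩ π → w ⊩ φ) (disjuncts d)
    disjuncts-entail top      = (λ _ h → h) ∷ []
    disjuncts-entail bot      = (λ _ h → h) ∷ []
    disjuncts-entail (neg _)  = (λ _ h → h) ∷ []
    disjuncts-entail (atom _) = (λ _ h → h) ∷ []
    disjuncts-entail (and {φ = φ} {ψ} d e) =
      All-cartesianProductWith⁺ _⊓_ (disjuncts-entail d) (disjuncts-entail e)
        λ {a} {b} a⊨φ b⊨ψ w h →
          let (⊩a , ⊩b) = to (⊩⊓ a b) h in from (⊩∧ φ ψ) (a⊨φ w ⊩a , b⊨ψ w ⊩b)
    disjuncts-entail (dia d) =
      map⁺ (All.map (λ a⊨φ w ⊩◇a ¬◇φ → ⊩◇a (λ v wRv ⊩a → ¬◇φ v wRv (a⊨φ v ⊩a)))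
                    (disjuncts-entail d))
    disjuncts-entail (or d e) =
      ++⁺ (All.map (λ a⊨φ w ⊩a ¬φ∨ψ → proj₁ ¬φ∨ψ (a⊨φ w ⊩a)) (disjuncts-entail d))
          (All.map (λ b⊨ψ w ⊩b ¬φ∨ψ → proj₂ ¬φ∨ψ (b⊨ψ w ⊩b)) (disjuncts-entail e))

    ⊩-someDisjunct : ∀ {At : Fm Prop → Set} {φ} (d : Ante At general φ) {w} →
                     w ⊩ φ → ¬ ¬ Any (w ⊩_) (disjuncts d)
    ⊩-someDisjunct top      h k = k (here h)
    ⊩-someDisjunct bot      h k = k (here h)
    ⊩-someDisjunct (neg _)  h k = k (here h)
    ⊩-someDisjunct (atom _) h k = k (here h)
    ⊩-someDisjunct (and {φ = φ} {ψ} d e) h k =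
      let (⊩φ , ⊩ψ) = to (⊩∧ φ ψ) h in
      ⊩-someDisjunct d ⊩φ λ someD → ⊩-someDisjunct e ⊩ψ λ someE →
        k (Anyₚ.cartesianProductWith⁺ _⊓_ (λ ⊩a ⊩b → from (⊩⊓ _ _) (⊩a , ⊩b)) someD someE)
    ⊩-someDisjunct (dia d) h k =
      h (λ v wRv ⊩φ → ⊩-someDisjunct d ⊩φ λ some →
        k (Anyₚ.map⁺ (Any.map (λ ⊩a ¬◇a → ¬◇a v wRv ⊩a) some)))
    ⊩-someDisjunct (or d e) h k =
      h ((λ ⊩φ → ⊩-someDisjunct d ⊩φ (k ∘ Anyₚ.++⁺ˡ)) ,
         (λ ⊩ψ → ⊩-someDisjunct e ⊩ψ (k ∘ Anyₚ.++⁺ʳ _)))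

    →-disjuncts : ∀ {At : Fm Prop → Set} {φ} (d : Ante At general φ) ψ {w} →
                  (w ⊩ φ → w ⊩ ψ) ⇔ All (λ π → w ⊩ π → w ⊩ ψ) (disjuncts d)
    →-disjuncts d ψ = mk⇔
      (λ φ→ψ → All.map (λ π⊨φ ⊩π → φ→ψ (π⊨φ _ ⊩π)) (disjuncts-entail d))
      (λ π→ψ ⊩φ → ⊩-stable ψ λ ¬ψ → ⊩-someDisjunct d ⊩φ λ some →
        let (⊩π→ψ , ⊩π) = All.lookupAny π→ψ some in ¬ψ (⊩π→ψ ⊩π))

    ⇒-disjuncts : ∀ {At : Fm Prop → Set} {φ} (d : Ante At general φ) ψ {w} →
                  w ⊩ φ ⇒ ψ ⇔ w ⊩ ⋀ (map (_⇒ ψ) (disjuncts d))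
    ⇒-disjuncts {φ = φ} d ψ {w} = begin
      w ⊩ φ ⇒ ψ                                ∼⟨ ⊩⇒ φ ψ ⟩
      (w ⊩ φ → w ⊩ ψ)                          ∼⟨ →-disjuncts d ψ ⟩
      All (λ π → w ⊩ π → w ⊩ ψ) (disjuncts d)  ∼⟨ mk⇔ (All.map (from (⊩⇒ _ ψ)))
                                                        (All.map (to (⊩⇒ _ ψ))) ⟩
      All (λ π → w ⊩ π ⇒ ψ) (disjuncts d)      ∼⟨ mk⇔ map⁺ map⁻ ⟩
      All (w ⊩_) (map (_⇒ ψ) (disjuncts d))    ∼⟨ ⇔-sym (⊩⋀ _) ⟩
      w ⊩ ⋀ (map (_⇒ ψ) (disjuncts d))         ∎
      where open Related.EquationalReasoning

Atom : {Prop : Set} → Class → Fm Prop → Set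
Atom verySimpleSahlqvist = IsVar
Atom sahlqvist           = BoxedAtom
Atom atomicInductive     = AtomicBox

ante : ∀ {Prop : Set} c {s} {φ : Fm Prop} → AnteOf c s φ → Ante (Atom c) s φ
ante verySimpleSahlqvist d       = d
ante sahlqvist           d       = d
ante atomicInductive     (d , _) = d

disjuncts-inClass : ∀ {Prop : Set} c {φ : Fm Prop} (d : AnteOf c general φ) →
                    All (AnteOf c definite) (disjuncts (ante c d))
disjuncts-inClass verySimpleSahlqvist d = disjuncts-definite d
disjuncts-inClass sahlqvist           d = disjuncts-definite d
disjuncts-inClass atomicInductive     (d , acyclic) =
  All.zip (disjuncts-definite d , disjuncts-acyclic d acyclic)

proposition2p6 : {Prop : Set} (c : Class) (φ : Fm Prop) →
    InClass c general φ →
    Σ (List (Fm Prop)) λ ψs → All (InClass c definite) ψs × SemEquiv φ (⋀ ψs)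
proposition2p6 c .(φ ⇒ ψ) (φ , ψ , refl , d , positive) =
  map (_⇒ ψ) (disjuncts (ante c d)) ,
  map⁺ (All.map (λ d′ → _ , ψ , refl , d′ , positive) (disjuncts-inClass c d)) ,
  λ M w → Semantics.⇒-disjuncts M (ante c d) ψ
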